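{- Let $k,n$ be positive integers. There is a bijection between $\mathrm{Mat}_{k,n}\times\mathcal R_n\times[k]^{n-1}$ and $\mathrm{ST}_{k,n}$.
   Context: $\mathrm{Mat}_{k,n}$ is the set of $kn\times n$ $\{0,1\}$-matrices with exactly one $1$ in each row and exactly $k$ $1$'s in each column. $\mathcal R_n$ is the set of rooted trees on the vertex set $\{w_1,\dots,w_n\}$ with root $w_n$. $[k]=\{1,\dots,k\}$. $\mathrm{ST}_{k,n}$ is the set of spanning trees of the complete bipartite graph $K_{kn,n}$ (left vertices $u_1,\dots,u_{kn}$, right vertices $w_1,\dots,w_n$) whose right degree sequence is $(k+1,\dots,k+1,k)$, i.e., $w_1,\dots,w_{n-1}$ have degree $k+1$ and $w_n$ has degree $k$. -}

module Defs where

open import Level using (0ℓ)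
open import Data.Nat using (ℕ; zero; suc; _+_; _*_; _∸_; _≤_)
open import Data.Bool using (Bool; true; false; T)
open import Data.Fin using (Fin; toℕ; splitAt)
open import Data.Sum using (_⊎_; inj₁; inj₂)
open import Data.Vec using (Vec; []; _∷_; lookup; map)
open import Data.List using (List; []; _∷_; _++_; [_]; length)
open import Data.List.Relation.Unary.Linked using (Linked)
open import Data.List.Relation.Unary.Unique.Propositional using (Unique)
open import Data.Product using (Σ; _×_)
open import Relation.Nullary using (¬_)
open import Relation.Binary using (Setoid)
open import Relation.Binary.PropositionalEquality using (_≡_; _≢_; refl; sym; trans)

ones : ∀ {m} → Vec Bool m → ℕ
ones []           = 0
ones (true  ∷ bs) = suc (ones bs)
ones (false ∷ bs) = ones bs

column : ∀ {m n} → Vec (Vec Bool n) m → Fin n → Vec Bool m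
column M j = map (λ row → lookup row j) M

Adj : ℕ → Set
Adj m = Fin m → Fin m → Bool

data Reach {m} (adj : Adj m) : Fin m → Fin m → Set where
  here : ∀ {x} → Reach adj x x
  step : ∀ {x y z} → T (adj x y) → Reach adj y z → Reach adj x z

Connected : ∀ {m} → Adj m → Set
Connected adj = ∀ x y → Reach adj x y

IsCycle : ∀ {m} → Adj m → Fin m → List (Fin m) → Set
IsCycle adj v vs =
  (2 ≤ length vs) × Unique (v ∷ vs) × Linked (λ x y → T (adj x y)) ((v ∷ vs) ++ [ v ])

Acyclic : ∀ {m} → Adj m → Set
Acyclic adj = ∀ v vs → ¬ IsCycle adj v vs

IsTree : ∀ {m} → Adj m → Set
IsTree adj = Connected adj × Acyclic adj

MatData : ℕ → ℕ → Set
MatData k n = Vec (Vec Bool n) (k * n)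

IsMat : (k n : ℕ) → MatData k n → Set
IsMat k n M = (∀ i → ones (lookup M i) ≡ 1) × (∀ j → ones (column M j) ≡ k)

-- R_n: rooted trees on {w_1,…,w_n} with root w_n (= the last element of
-- Fin n).  Since the root is fixed, such a rooted tree is determined by its
-- underlying tree, given by a symmetric, irreflexive adjacency matrix.

TreeData : ℕ → Set
TreeData n = Vec (Vec Bool n) n

matAdj : ∀ {n} → TreeData n → Adj n
matAdj A i j = lookup (lookup A i) j

IsRootedTree : (n : ℕ) → TreeData n → Set
IsRootedTree n A =
  (∀ i j → matAdj A i j ≡ matAdj A j i) × (∀ i → matAdj A i i ≡ false) × IsTree (matAdj A)

-- A spanning subgraph of K_{kn,n} is
-- given by its biadjacency matrix B (B i j = true iff u_i — w_j is an edge).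
-- Vertices of the graph: Fin (k*n + n), the first k*n are u_1…u_{kn}, the
-- last n are w_1…w_n.

BipData : ℕ → ℕ → Set
BipData k n = Vec (Vec Bool n) (k * n)

bipAdj : ∀ {k n} → BipData k n → Adj (k * n + n)
bipAdj {k} {n} B x y with splitAt (k * n) x | splitAt (k * n) y
... | inj₁ i | inj₂ j = lookup (lookup B i) j
... | inj₂ j | inj₁ i = lookup (lookup B i) j
... | inj₁ _ | inj₁ _ = false
... | inj₂ _ | inj₂ _ = false

RightDegrees : (k n : ℕ) → BipData k n → Set
RightDegrees k n B =
  ∀ j → (toℕ j ≡ n ∸ 1 → ones (column B j) ≡ k)
      × (toℕ j ≢ n ∸ 1 → ones (column B j) ≡ suc k)

IsST : (k n : ℕ) → BipData k n → Set
IsST k n B = IsTree (bipAdj {k} {n} B) × RightDegrees k n B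

-- A "set" {d : D | P d} as a setoid: elements are compared by their data
-- only (proof components are irrelevant).

SubSetoid : (D : Set) → (D → Set) → Setoid 0ℓ 0ℓ
SubSetoid D P = record
  { Carrier       = Σ D P
  ; _≈_           = λ x y → Σ.proj₁ x ≡ Σ.proj₁ y
  ; isEquivalence = record { refl = refl ; sym = sym ; trans = trans }
  }

DomData : ℕ → ℕ → Set
DomData k n = MatData k n × TreeData n × Vec (Fin k) (n ∸ 1)

InDom : (k n : ℕ) → DomData k n → Set
InDom k n (M Data.Product., A Data.Product., _) = IsMat k n M × IsRootedTree n A

MatRTreeWords : ℕ → ℕ → Setoid 0ℓ 0ℓ
MatRTreeWords k n = SubSetoid (DomData k n) (InDom k n)

STSet : ℕ → ℕ → Setoid 0ℓ 0ℓ
STSet k n = SubSetoid (BipData k n) (IsST k n)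

-- A tree on a finite vertex set is the same as the graph of a parent function
-- with a strictly decreasing height, and a graph has at most one parent
-- function towards a given root; so tree conditions reduce to statements about
-- parent functions.
--
-- Given (M, T, a), join each u_i to the w-vertex of the column of its 1 and,
-- for every non-root w_j with T-parent w_p, join w_j to the a_j-th u-vertex
-- among the k with a 1 in column p.  Oriented towards w_n, u_i hangs below its
-- column vertex and w_j below the chosen u-vertex, so the result is a spanning
-- tree, and each non-root w_j gains exactly one edge: the right degrees become
-- (k+1,…,k+1,k).
-- Conversely, in a spanning tree oriented towards w_n, the parents of the
-- u-vertices give back M, the grandparent of w_j is its T-parent, and the rank
-- of the parent of w_j among the u-vertices of that column is a_j.

module Submission where

open import Data.Bool using (Bool; true; false; T; _∨_)
open import Data.Bool.Properties using (∨-identityʳ; T-∨; T?)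
open import Data.Empty using (⊥; ⊥-elim)
open import Data.Fin using (Fin; zero; suc; toℕ; fromℕ; inject₁; lower₁; splitAt; _↑ˡ_; _↑ʳ_)
open import Data.Fin.Properties using (_≟_; any?)
import Data.Fin.Properties as Fin
open import Data.List using (List; []; _∷_; _++_; [_]; length; reverse)
open import Data.List.Properties using (++-assoc; length-++; length-reverse; reverse-++; unfold-reverse)
open import Data.List.Membership.Propositional using (_∈_; _∉_)
open import Data.List.Membership.Propositional.Properties using (∈-∃++; ∈-++⁺ˡ)
import Data.List.Membership.DecPropositional as DecMembership
open import Data.List.Relation.Binary.Permutation.Propositional using (↭-sym)
open import Data.List.Relation.Binary.Permutation.Propositional.Properties using (All-resp-↭; ↭-reverse)
open import Data.List.Relation.Unary.All using (All; []; _∷_)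
import Data.List.Relation.Unary.All as All
import Data.List.Relation.Unary.All.Properties as Allₚ
open import Data.List.Relation.Unary.AllPairs using (AllPairs; []; _∷_)
import Data.List.Relation.Unary.AllPairs as AllPairs
import Data.List.Relation.Unary.AllPairs.Properties as AllPairsₚ
open import Data.List.Relation.Unary.Any using (Any; here; there)
import Data.List.Relation.Unary.Any as Any
import Data.List.Relation.Unary.Any.Properties as Anyₚ
import Data.List.Relation.Unary.First as First
open import Data.List.Relation.Unary.First.Properties using (toView)
open import Data.List.Relation.Unary.Linked using (Linked; []; [-]; _∷_)
import Data.List.Relation.Unary.Linked as Linked
import Data.List.Relation.Unary.Linked.Properties as Linkedₚ
open import Data.Maybe using (Maybe; just; nothing; fromMaybe)
import Data.Maybe as Maybe
open import Data.Nat using (ℕ; zero; suc; _+_; _*_; _≤_; _<_; z≤n; s≤s)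
open import Data.Nat.DivMod using (_mod_; m<n⇒m%n≡m)
open import Data.Nat.Induction using (<-wellFounded)
open import Data.Nat.Properties
  using ( module ≤-Reasoning; suc-injective; +-suc; +-mono-≤; <-irrefl; <-trans; ≤-refl; ≤-trans; ≤-pred; ≰⇒>
        ; m≤n⇒m<n∨m≡n; m≤n+m)
open import Data.Product using (Σ; ∃-syntax; _×_; _,_; proj₁; proj₂)
open import Data.Sum using (_⊎_; inj₁; inj₂)
import Data.Sum as Sum
open import Data.Unit using (tt)
open import Data.Vec using (Vec; []; _∷_; _∷ʳ_; lookup; tabulate)
open import Data.Vec.Properties using (tabulate-cong; lookup∘tabulate; tabulate∘lookup; lookup-map)
open import Function using (id; _∘_; mk⇔; Equivalence)
open import Function.Bundles using (Bijection; Inverse)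
open import Function.Properties.Inverse using (Inverse⇒Bijection)
open import Induction.WellFounded using (Acc; acc)
open import Level using (Level)
open import Relation.Binary using (DecidableEquality)
open import Relation.Binary.PropositionalEquality
  using (_≡_; _≢_; refl; sym; trans; cong; cong₂; subst; ≢-sym; module ≡-Reasoning)
open import Relation.Nullary using (¬_; Dec; yes; no; toSum)
open import Relation.Nullary.Decidable using (¬?; _×-dec_; _⊎-dec_; does; does-⇔; dec-true; dec-false)
open import Relation.Unary using (Decidable)

open import Defs

private variable
  a ℓ : Level
  A : Set a

-- Lists and least witnesses

module _ {R : A → A → Set ℓ} where

  Linked-prefix : ∀ xs {c ys} → Linked R (xs ++ c ∷ ys) → Linked R (xs ++ [ c ])
  Linked-prefix []           _        = [-]
  Linked-prefix (x ∷ [])     (r ∷ _)  = r ∷ [-]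
  Linked-prefix (x ∷ y ∷ xs) (r ∷ rs) = r ∷ Linked-prefix (y ∷ xs) rs

  Linked-join : ∀ xs {c ys} → Linked R (xs ++ [ c ]) → Linked R (c ∷ ys) → Linked R (xs ++ c ∷ ys)
  Linked-join []           _        rs′ = rs′
  Linked-join (x ∷ [])     (r ∷ _)  rs′ = r ∷ rs′
  Linked-join (x ∷ y ∷ xs) (r ∷ rs) rs′ = r ∷ Linked-join (y ∷ xs) rs rs′

  Linked-reverse : (∀ {x y} → R x y → R y x) → ∀ {xs} → Linked R xs → Linked R (reverse xs)
  Linked-reverse R-sym {[]}         _        = []
  Linked-reverse R-sym {x ∷ []}     _        = [-]
  Linked-reverse R-sym {x ∷ y ∷ xs} (r ∷ rs)
    rewrite unfold-reverse x (y ∷ xs) | unfold-reverse y xs | ++-assoc (reverse xs) [ y ] [ x ] =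
    Linked-join (reverse xs) (subst (Linked R) (unfold-reverse y xs) (Linked-reverse R-sym rs)) (R-sym r ∷ [-])

  AllPairs-++⁻ : ∀ xs {ys} → AllPairs R (xs ++ ys) →
                 AllPairs R xs × All (λ x → All (R x) ys) xs × AllPairs R ys
  AllPairs-++⁻ []       ps       = [] , [] , ps
  AllPairs-++⁻ (x ∷ xs) (p ∷ ps) with AllPairs-++⁻ xs ps
  ... | pxs , across , pys = Allₚ.++⁻ˡ xs p ∷ pxs , Allₚ.++⁻ʳ xs p ∷ across , pys

  AllPairs-reverse : (∀ {x y} → R x y → R y x) → ∀ {xs} → AllPairs R xs → AllPairs R (reverse xs)
  AllPairs-reverse R-sym {[]}     []       = []
  AllPairs-reverse R-sym {x ∷ xs} (p ∷ ps) rewrite unfold-reverse x xs =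
    AllPairsₚ.++⁺ (AllPairs-reverse R-sym ps) ([] ∷ [])
      (All-resp-↭ (↭-sym (↭-reverse xs)) (All.map (λ r → R-sym r ∷ []) p))

splice-distinct : ∀ A₁ {c} {A₂} B₁ {B₂ : List A} →
                  AllPairs _≢_ (A₁ ++ c ∷ A₂) → AllPairs _≢_ (B₁ ++ c ∷ B₂) →
                  All (_∉ B₁) A₁ → AllPairs _≢_ (A₁ ++ c ∷ reverse B₁)
splice-distinct A₁ {c} {A₂} B₁ distinctA distinctB A₁∉B₁
  with AllPairs-++⁻ A₁ distinctA | AllPairs-++⁻ B₁ distinctB
... | distinctA₁ , A₁≢c∷A₂ , _ | distinctB₁ , B₁≢c∷B₂ , _ =
  AllPairsₚ.++⁺ distinctA₁ (c≢reverseB₁ ∷ AllPairs-reverse ≢-sym distinctB₁)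
    (All.zipWith A₁≢c∷reverseB₁ (A₁≢c∷A₂ , A₁∉B₁))
  where
    c≢reverseB₁ : All (c ≢_) (reverse B₁)
    c≢reverseB₁ = All-resp-↭ (↭-sym (↭-reverse B₁))
                    (All.map (λ b≢c∷B₂ → ≢-sym (All.head b≢c∷B₂)) B₁≢c∷B₂)
    A₁≢c∷reverseB₁ : ∀ {a} → All (a ≢_) (c ∷ A₂) × a ∉ B₁ → All (a ≢_) (c ∷ reverse B₁)
    A₁≢c∷reverseB₁ (a≢c ∷ _ , a∉B₁) =
      a≢c ∷ All.tabulate (λ b∈ a≡b → a∉B₁ (subst (_∈ B₁) (sym a≡b) (Anyₚ.reverse⁻ b∈)))

splice-linked : ∀ {R : A → A → Set ℓ} → (∀ {x y} → R x y → R y x) →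
                ∀ A₁ {c A₂} {x} B₁ {B₂} →
                Linked R (A₁ ++ c ∷ A₂) → Linked R (x ∷ B₁ ++ c ∷ B₂) →
                Linked R ((A₁ ++ c ∷ reverse B₁) ++ [ x ])
splice-linked {R = R} R-sym A₁ {c} {x = x} B₁ linkedA linkedB
  rewrite ++-assoc A₁ (c ∷ reverse B₁) [ x ] =
  Linked-join A₁ (Linked-prefix A₁ linkedA)
    (subst (Linked R) reverse-eq (Linked-reverse R-sym (Linked-prefix (x ∷ B₁) linkedB)))
  where
    reverse-eq : reverse (x ∷ B₁ ++ [ c ]) ≡ c ∷ reverse B₁ ++ [ x ]
    reverse-eq = trans (unfold-reverse x (B₁ ++ [ c ])) (cong (_++ [ x ]) (reverse-++ B₁ [ c ]))

first-common : DecidableEquality A → ∀ {xs ys : List A} → Any (_∈ ys) xs →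
               ∃[ xs₁ ] ∃[ c ] ∃[ xs₂ ] xs ≡ xs₁ ++ c ∷ xs₂ × All (_∉ ys) xs₁ × c ∈ ys
first-common _≟_ {xs} {ys} common with First.first (λ z → Sum.swap (toSum (z ∈? ys))) xs
  where open DecMembership _≟_
... | inj₂ none = ⊥-elim (Allₚ.All¬⇒¬Any none common)
... | inj₁ found with toView found
...   | First._++_∷_ outside c∈ys xs₂ = _ , _ , xs₂ , refl , outside , c∈ys

LeastWitness : ∀ {p} → (ℕ → Set p) → Set p
LeastWitness P = ∃[ d ] P d × (∀ {e} → P e → d ≤ e)

module _ {p} {P : ℕ → Set p} (P? : Decidable P) where

  least-or-none : ∀ n → LeastWitness P ⊎ (∀ {e} → e ≤ n → ¬ P e)
  least-or-none zero with P? zero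
  ... | yes p = inj₁ (zero , p , λ _ → z≤n)
  ... | no ¬p = inj₂ λ { z≤n → ¬p }
  least-or-none (suc n) with least-or-none n
  ... | inj₁ least = inj₁ least
  ... | inj₂ none with P? (suc n)
  ...   | yes p = inj₁ (suc n , p , λ pe → ≰⇒> (λ e≤n → none e≤n pe))
  ...   | no ¬p = inj₂ none′
    where
      none′ : ∀ {e} → e ≤ suc n → ¬ P e
      none′ e≤1+n with m≤n⇒m<n∨m≡n e≤1+n
      ... | inj₁ e<1+n = none (≤-pred e<1+n)
      ... | inj₂ refl  = ¬p

  least-witness : ∀ {n} → P n → LeastWitness P
  least-witness {n} p with least-or-none n
  ... | inj₁ least = least
  ... | inj₂ none  = ⊥-elim (none ≤-refl p)

lastStep : A → A → List A → A × A
lastStep x y []       = x , y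
lastStep x y (z ∷ zs) = lastStep y z zs

lastStep-∷ʳ : ∀ (x y : A) zs z → lastStep x y (zs ++ [ z ]) ≡ (proj₂ (lastStep x y zs) , z)
lastStep-∷ʳ x y []       z = refl
lastStep-∷ʳ x y (w ∷ zs) z = lastStep-∷ʳ y w zs z

lastStep-∈ : ∀ (x y : A) zs → proj₂ (lastStep x y zs) ∈ y ∷ zs
lastStep-∈ x y []       = here refl
lastStep-∈ x y (z ∷ zs) = there (lastStep-∈ y z zs)

data NonBacktracking {A : Set a} : A → A → List A → Set a where
  []  : ∀ {x y} → NonBacktracking x y []
  _∷_ : ∀ {x y z zs} → x ≢ z → NonBacktracking y z zs → NonBacktracking x y (z ∷ zs)

distinct⇒NonBacktracking : ∀ {x y : A} {zs} → AllPairs _≢_ (x ∷ y ∷ zs) → NonBacktracking x y zs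
distinct⇒NonBacktracking {zs = []}     _                    = []
distinct⇒NonBacktracking {zs = z ∷ zs} ((_ ∷ x≢z ∷ _) ∷ ps) = x≢z ∷ distinct⇒NonBacktracking ps

cycle-nonBacktracking : ∀ {v c d : A} cs → AllPairs _≢_ (v ∷ c ∷ d ∷ cs) →
                        NonBacktracking v c (d ∷ cs ++ [ v ])
cycle-nonBacktracking cs (v≢@(_ ∷ v≢d ∷ _) ∷ distinct) =
  v≢d ∷ distinct⇒NonBacktracking
          (AllPairsₚ.++⁺ distinct ([] ∷ []) (All.map (λ v≢x → ≢-sym v≢x ∷ []) v≢))

-- Parent functions of graphs

SymmetricAdj : ∀ {m} → Adj m → Set
SymmetricAdj adj = ∀ {x y} → T (adj x y) → T (adj y x)

IrreflexiveAdj : ∀ {m} → Adj m → Set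
IrreflexiveAdj adj = ∀ {x} → ¬ T (adj x x)

module _ {m} {adj : Adj m} where

  Reach-trans : ∀ {x y z} → Reach adj x y → Reach adj y z → Reach adj x z
  Reach-trans here       q = q
  Reach-trans (step e p) q = step e (Reach-trans p q)

  Reach-sym : SymmetricAdj adj → ∀ {x y} → Reach adj x y → Reach adj y x
  Reach-sym adj-sym here       = here
  Reach-sym adj-sym (step e p) = Reach-trans (Reach-sym adj-sym p) (step (adj-sym e) here)

ParentStep : ∀ {m} → Fin m → (Fin m → Fin m) → Fin m → Fin m → Set
ParentStep r parent x y = x ≢ r × y ≡ parent x

parentStep? : ∀ {m} (r : Fin m) parent x y → Dec (ParentStep r parent x y)
parentStep? r parent x y = ¬? (x ≟ r) ×-dec (y ≟ parent x)

record ParentFunction {m} (r : Fin m) : Set where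
  field
    parent        : Fin m → Fin m
    height        : Fin m → ℕ
    parent-root   : parent r ≡ r
    height-parent : ∀ {x} → x ≢ r → height (parent x) < height x

record ParentFunctionOf {m} (adj : Adj m) (r : Fin m) : Set where
  field
    parentFunction : ParentFunction r
  open ParentFunction parentFunction public
  field
    parent-adjacent       : ∀ {x} → x ≢ r → T (adj x (parent x))
    adjacent⇒parent-step : ∀ {x y} → T (adj x y) → ParentStep r parent x y ⊎ ParentStep r parent y x

module Ancestry {m} {r : Fin m} (F : ParentFunction r) where
  open ParentFunction F

  path-to-root : ∀ x → ∃[ xs ] Linked (ParentStep r parent) (x ∷ xs) × r ∈ x ∷ xs
  path-to-root x = go x (<-wellFounded (height x))
    where
      go : ∀ x → Acc _<_ (height x) → ∃[ xs ] Linked (ParentStep r parent) (x ∷ xs) × r ∈ x ∷ xs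
      go x (acc rs) with x ≟ r
      ... | yes x≡r = [] , [-] , here (sym x≡r)
      ... | no x≢r with go (parent x) (rs (height-parent x≢r))
      ...   | xs , steps , r∈ = parent x ∷ xs , (x≢r , refl) ∷ steps , there r∈

  ParentSteps⇒distinct : ∀ {xs} → Linked (ParentStep r parent) xs → AllPairs _≢_ xs
  ParentSteps⇒distinct steps =
    AllPairs.map (λ lt x≡y → <-irrefl (cong height (sym x≡y)) lt)
      (Linkedₚ.Linked⇒AllPairs (λ p q → <-trans q p) (Linked.map step-descends steps))
    where
      step-descends : ∀ {x y} → ParentStep r parent x y → height y < height x
      step-descends (x≢r , refl) = height-parent x≢r

module _ {m} {adj : Adj m} {r} (P Q : ParentFunctionOf adj r) where
  private
    module P = ParentFunctionOf P
    module Q = ParentFunctionOf Q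

  -- After a Q-step x ↦ y, a P-step y ↦ x back would force ever smaller Q-heights.
  no-inversion : ∀ x → Acc _<_ (Q.height x) → x ≢ r → Q.parent x ≢ r → x ≢ P.parent (Q.parent x)
  no-inversion x (acc rs) x≢r y≢r x≡Py with P.adjacent⇒parent-step (Q.parent-adjacent y≢r)
  ... | inj₁ (_ , Qy≡Py) =
    <-irrefl (cong Q.height (trans Qy≡Py (sym x≡Py))) (<-trans (Q.height-parent y≢r) (Q.height-parent x≢r))
  ... | inj₂ (Qy≢r , y≡PQy) = no-inversion (Q.parent x) (rs (Q.height-parent x≢r)) y≢r Qy≢r y≡PQy

  parent-unique : ∀ x → P.parent x ≡ Q.parent x
  parent-unique x with x ≟ r
  ... | yes refl = trans P.parent-root (sym Q.parent-root)
  ... | no x≢r with P.adjacent⇒parent-step (Q.parent-adjacent x≢r)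
  ...   | inj₁ (_ , Qx≡Px)    = sym Qx≡Px
  ...   | inj₂ (Qx≢r , x≡PQx) = ⊥-elim (no-inversion x (<-wellFounded _) x≢r Qx≢r x≡PQx)

module ParentFunctionOf⇒Tree {m} {adj : Adj m} {r} (adj-sym : SymmetricAdj adj) (P : ParentFunctionOf adj r) where
  open ParentFunctionOf P

  Edge : Fin m → Fin m → Set
  Edge x y = T (adj x y)

  Up : Fin m → Fin m → Set
  Up = ParentStep r parent

  reaches-root : ∀ x → Reach adj x r
  reaches-root x = go x (<-wellFounded (height x))
    where
      go : ∀ x → Acc _<_ (height x) → Reach adj x r
      go x (acc rs) with x ≟ r
      ... | yes refl = here
      ... | no x≢r   = step (parent-adjacent x≢r) (go (parent x) (rs (height-parent x≢r)))

  connected : Connected adj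
  connected x y = Reach-trans (reaches-root x) (Reach-sym adj-sym (reaches-root y))

  -- Without backtracking, a walk that has stepped down from a parent to a
  -- child can never step up again.
  down-stays-down : ∀ {x y} zs {p q} → lastStep x y zs ≡ (p , q) →
                    Linked Edge (x ∷ y ∷ zs) → NonBacktracking x y zs → Up y x →
                    height x < height q × Up q p
  down-stays-down []       refl _              _              (y≢r , refl) = height-parent y≢r , y≢r , refl
  down-stays-down (z ∷ zs) ends (_ ∷ e ∷ walk) (x≢z ∷ noBack) (y≢r , refl) with adjacent⇒parent-step e
  ... | inj₁ (_ , refl) = ⊥-elim (x≢z refl)
  ... | inj₂ z↑y with down-stays-down zs ends (e ∷ walk) noBack z↑y
  ...   | y<q , q↑p = <-trans (height-parent y≢r) y<q , q↑p

  up-until-down : ∀ {x y} zs {p q} → lastStep x y zs ≡ (p , q) →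
                  Linked Edge (x ∷ y ∷ zs) → NonBacktracking x y zs → Up x y →
                  height q < height x ⊎ Up q p
  up-until-down []       refl _              _            (x≢r , refl) = inj₁ (height-parent x≢r)
  up-until-down (z ∷ zs) ends (_ ∷ e ∷ walk) (_ ∷ noBack) (x≢r , refl) with adjacent⇒parent-step e
  ... | inj₂ z↑y = inj₂ (proj₂ (down-stays-down zs ends (e ∷ walk) noBack z↑y))
  ... | inj₁ y↑z with up-until-down zs ends (e ∷ walk) noBack y↑z
  ...   | inj₁ q<y = inj₁ (<-trans q<y (height-parent x≢r))
  ...   | inj₂ q↑p = inj₂ q↑p

  acyclic : Acyclic adj
  acyclic v []           (() , _)
  acyclic v (_ ∷ [])     (s≤s () , _)
  acyclic v (c ∷ d ∷ cs) (_ , distinct , walk@(e ∷ _))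
    with adjacent⇒parent-step e | lastStep-∷ʳ v c (d ∷ cs) v | cycle-nonBacktracking cs distinct
  ... | inj₂ c↑v | ends | noBack = <-irrefl refl (proj₁ (down-stays-down _ ends walk noBack c↑v))
  ... | inj₁ v↑c@(_ , c≡pv) | ends | noBack with up-until-down _ ends walk noBack v↑c
  ...   | inj₁ v<v        = <-irrefl refl v<v
  ...   | inj₂ (_ , p≡pv) =
    All.lookup (AllPairs.head (AllPairs.tail distinct)) (lastStep-∈ c d cs) (trans c≡pv (sym p≡pv))

  isTree : IsTree adj
  isTree = connected , acyclic

module Tree⇒ParentFunctionOf {m} {adj : Adj m} (adj-sym : SymmetricAdj adj) (adj-irrefl : IrreflexiveAdj adj)
                      (tree : IsTree adj) (r : Fin m) where

  Edge : Fin m → Fin m → Set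
  Edge x y = T (adj x y)

  WithinDistance : ℕ → Fin m → Set
  WithinDistance zero    x = x ≡ r
  WithinDistance (suc d) x = WithinDistance d x ⊎ ∃[ y ] Edge x y × WithinDistance d y

  withinDistance? : ∀ d → Decidable (WithinDistance d)
  withinDistance? zero    x = x ≟ r
  withinDistance? (suc d) x = withinDistance? d x ⊎-dec any? (λ y → T? (adj x y) ×-dec withinDistance? d y)

  Reach⇒WithinDistance : ∀ {x} → Reach adj x r → ∃[ d ] WithinDistance d x
  Reach⇒WithinDistance here       = zero , refl
  Reach⇒WithinDistance (step e p) with Reach⇒WithinDistance p
  ... | d , within = suc d , inj₂ (_ , e , within)

  distance : ∀ x → LeastWitness (λ d → WithinDistance d x)
  distance x = least-witness (λ d → withinDistance? d x) (proj₂ (Reach⇒WithinDistance (proj₁ tree x r)))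

  dist : Fin m → ℕ
  dist x = proj₁ (distance x)

  closer-neighbour : ∀ {x} → x ≢ r → ∃[ y ] Edge x y × dist y < dist x
  closer-neighbour {x} x≢r with distance x
  ... | zero  , x≡r                  , _     = ⊥-elim (x≢r x≡r)
  ... | suc d , inj₁ within          , least = ⊥-elim (<-irrefl refl (least within))
  ... | suc d , inj₂ (y , e , within) , _    = y , e , s≤s (proj₂ (proj₂ (distance y)) within)

  bfsParent : Fin m → Fin m
  bfsParent x with x ≟ r
  ... | yes _  = r
  ... | no x≢r = proj₁ (closer-neighbour x≢r)

  bfsParent-root : bfsParent r ≡ r
  bfsParent-root with r ≟ r
  ... | yes _ = refl
  ... | no r≢r = ⊥-elim (r≢r refl)

  bfsParent-adjacent : ∀ {x} → x ≢ r → Edge x (bfsParent x)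
  bfsParent-adjacent {x} x≢r with x ≟ r
  ... | yes x≡r = ⊥-elim (x≢r x≡r)
  ... | no x≢r′ = proj₁ (proj₂ (closer-neighbour x≢r′))

  dist-bfsParent : ∀ {x} → x ≢ r → dist (bfsParent x) < dist x
  dist-bfsParent {x} x≢r with x ≟ r
  ... | yes x≡r = ⊥-elim (x≢r x≡r)
  ... | no x≢r′ = proj₂ (proj₂ (closer-neighbour x≢r′))

  bfsParentFunction : ParentFunction r
  bfsParentFunction = record
    { parent = bfsParent ; height = dist ; parent-root = bfsParent-root ; height-parent = dist-bfsParent }

  open Ancestry bfsParentFunction

  Up : Fin m → Fin m → Set
  Up = ParentStep r bfsParent

  Up⇒Edge : ∀ {x y} → Up x y → Edge x y
  Up⇒Edge (x≢r , refl) = bfsParent-adjacent x≢r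

  splice-cycle : ∀ {x} A₁ {c A₂} B₁ {B₂} →
                 Linked Up (A₁ ++ c ∷ A₂) → Linked Edge (x ∷ B₁ ++ c ∷ B₂) →
                 Linked Up (B₁ ++ c ∷ B₂) → All (_∉ B₁) A₁ →
                 ∀ {vs} → x ∷ vs ≡ A₁ ++ c ∷ reverse B₁ → 2 ≤ length vs → IsCycle adj x vs
  splice-cycle {x} A₁ B₁ upA linkedB upB A₁∉B₁ eq 2≤length =
    2≤length ,
    subst (AllPairs _≢_) (sym eq)
      (splice-distinct A₁ B₁ (ParentSteps⇒distinct upA) (ParentSteps⇒distinct upB) A₁∉B₁) ,
    subst (λ l → Linked Edge (l ++ [ x ])) (sym eq)
      (splice-linked adj-sym A₁ B₁ (Linked.map Up⇒Edge upA) linkedB)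

  -- The spliced closed walk through the edge x — y is too short to be a cycle
  -- only if x ≡ y or x — y is a parent edge.
  shortcut-cycle : ∀ {x y} → Edge x y → ¬ Up x y → ¬ Up y x →
                   ∀ {xs ys} → Linked Up (x ∷ xs) → Linked Up (y ∷ ys) →
                   ∀ A₁ {c} A₂ B₁ B₂ → x ∷ xs ≡ A₁ ++ c ∷ A₂ → y ∷ ys ≡ B₁ ++ c ∷ B₂ →
                   All (_∉ B₁) A₁ →
                   ∃[ vs ] IsCycle adj x vs
  shortcut-cycle e ¬x↑y ¬y↑x upX upY [] A₂ [] B₂ refl refl _ = ⊥-elim (adj-irrefl e)
  shortcut-cycle e ¬x↑y ¬y↑x upX (y↑x ∷ _) [] A₂ (_ ∷ []) B₂ refl refl _ = ⊥-elim (¬y↑x y↑x)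
  shortcut-cycle e ¬x↑y ¬y↑x upX upY [] A₂ B₁@(y ∷ b ∷ B₁′) B₂ refl refl A₁∉B₁ =
    reverse B₁ , splice-cycle [] B₁ upX (e ∷ Linked.map Up⇒Edge upY) upY A₁∉B₁ refl
                   (subst (2 ≤_) (sym (length-reverse B₁)) (s≤s (s≤s z≤n)))
  shortcut-cycle e ¬x↑y ¬y↑x (x↑y ∷ _) upY (_ ∷ []) A₂ [] B₂ refl refl _ = ⊥-elim (¬x↑y x↑y)
  shortcut-cycle e ¬x↑y ¬y↑x upX upY A₁@(x ∷ a ∷ A₁′) {c} A₂ [] B₂ refl refl A₁∉B₁ =
    a ∷ A₁′ ++ [ c ] ,
    splice-cycle A₁ [] upX (e ∷ Linked.map Up⇒Edge upY) upY A₁∉B₁ refl (two≤length a A₁′)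
    where two≤length : ∀ a A₁′ → 2 ≤ length (a ∷ A₁′ ++ [ c ])
          two≤length a []      = s≤s (s≤s z≤n)
          two≤length a (_ ∷ _) = s≤s (s≤s z≤n)
  shortcut-cycle e ¬x↑y ¬y↑x upX upY A₁@(x ∷ A₁′) {c} A₂ B₁@(b ∷ B₁′) B₂ refl refl A₁∉B₁ =
    A₁′ ++ c ∷ reverse B₁ , splice-cycle A₁ B₁ upX (e ∷ Linked.map Up⇒Edge upY) upY A₁∉B₁ refl
      (subst (2 ≤_) (sym (trans (length-++ A₁′) (cong (λ l → length A₁′ + suc l) (length-reverse B₁))))
        (≤-trans (s≤s (s≤s z≤n)) (m≤n+m (suc (length B₁)) (length A₁′))))

  -- Otherwise the paths from x and from y to the root, spliced at their first
  -- common vertex, close a cycle with the edge x — y.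
  adjacent⇒parent-step : ∀ {x y} → Edge x y → Up x y ⊎ Up y x
  adjacent⇒parent-step {x} {y} e with parentStep? r bfsParent x y | parentStep? r bfsParent y x
  ... | yes x↑y | _       = inj₁ x↑y
  ... | no _    | yes y↑x = inj₂ y↑x
  ... | no ¬x↑y | no ¬y↑x with path-to-root x | path-to-root y
  ...   | xs , upX , r∈X | ys , upY , r∈Y
    with first-common _≟_ (Any.map (λ r≡z → subst (_∈ y ∷ ys) r≡z r∈Y) r∈X)
  ...   | A₁ , c , A₂ , eqA , A₁∉Y , c∈Y with ∈-∃++ c∈Y
  ...   | B₁ , B₂ , eqB with shortcut-cycle e ¬x↑y ¬y↑x upX upY A₁ A₂ B₁ B₂ eqA eqB
                              (All.map (λ z∉Y z∈B₁ → z∉Y (subst (_ ∈_) (sym eqB) (∈-++⁺ˡ z∈B₁))) A₁∉Y)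
  ...   | vs , cycle = ⊥-elim (proj₂ tree x vs cycle)

  parentFunctionOf : ParentFunctionOf adj r
  parentFunctionOf = record
    { parentFunction        = bfsParentFunction
    ; parent-adjacent       = bfsParent-adjacent
    ; adjacent⇒parent-step = adjacent⇒parent-step
    }

T-does⁺ : ∀ {p} {P : Set p} (P? : Dec P) → P → T (does P?)
T-does⁺ (yes _) _  = tt
T-does⁺ (no ¬p) p = ¬p p

T-does⁻ : ∀ {p} {P : Set p} (P? : Dec P) → T (does P?) → P
T-does⁻ (yes p) _ = p

T⇔T⇒≡ : ∀ {a b} → (T a → T b) → (T b → T a) → a ≡ b
T⇔T⇒≡ {a} {b} a⇒b b⇒a = does-⇔ (mk⇔ a⇒b b⇒a) (T? a) (T? b)

parentAdj : ∀ {m} → Fin m → (Fin m → Fin m) → Adj m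
parentAdj r parent x y = does (parentStep? r parent x y ⊎-dec parentStep? r parent y x)

module _ {m} {r : Fin m} {parent : Fin m → Fin m} where

  parentAdj⁺ : ∀ x y → ParentStep r parent x y ⊎ ParentStep r parent y x → T (parentAdj r parent x y)
  parentAdj⁺ x y = T-does⁺ (parentStep? r parent x y ⊎-dec parentStep? r parent y x)

  parentAdj⁻ : ∀ x y → T (parentAdj r parent x y) → ParentStep r parent x y ⊎ ParentStep r parent y x
  parentAdj⁻ x y = T-does⁻ (parentStep? r parent x y ⊎-dec parentStep? r parent y x)

  parentAdj-comm : ∀ x y → parentAdj r parent x y ≡ parentAdj r parent y x
  parentAdj-comm x y =
    T⇔T⇒≡ (parentAdj⁺ y x ∘ Sum.swap ∘ parentAdj⁻ x y) (parentAdj⁺ x y ∘ Sum.swap ∘ parentAdj⁻ y x)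

parentAdj-cong : ∀ {m} (r : Fin m) {p q} → (∀ x → p x ≡ q x) →
                 ∀ x y → parentAdj r p x y ≡ parentAdj r q x y
parentAdj-cong r {p} {q} p≗q x y =
  T⇔T⇒≡ (parentAdj⁺ x y ∘ Sum.map (transport p≗q) (transport p≗q) ∘ parentAdj⁻ x y)
              (parentAdj⁺ x y ∘ Sum.map (transport (sym ∘ p≗q)) (transport (sym ∘ p≗q)) ∘ parentAdj⁻ x y)
  where
    transport : ∀ {p q} → (∀ x → p x ≡ q x) → ∀ {x y} → ParentStep r p x y → ParentStep r q x y
    transport p≗q {x} (x≢r , y≡px) = x≢r , trans y≡px (p≗q x)

module _ {m} {r : Fin m} (F : ParentFunction r) where
  open ParentFunction F

  parentAdj-irrefl : ∀ x → parentAdj r parent x x ≡ false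
  parentAdj-irrefl x = T⇔T⇒≡ (Sum.[ loop , loop ] ∘ parentAdj⁻ {parent = parent} x x) λ ()
    where
      loop : ParentStep r parent x x → ⊥
      loop (x≢r , x≡px) = <-irrefl (cong height (sym x≡px)) (height-parent x≢r)

  parentAdj-ParentFunctionOf : ParentFunctionOf (parentAdj r parent) r
  parentAdj-ParentFunctionOf = record
    { parentFunction        = F
    ; parent-adjacent       = λ {x} x≢r → parentAdj⁺ {parent = parent} x (parent x) (inj₁ (x≢r , refl))
    ; adjacent⇒parent-step = λ {x} {y} → parentAdj⁻ x y
    }

ParentFunctionOf-resp : ∀ {m} {adj adj′ : Adj m} {r} → (∀ x y → adj x y ≡ adj′ x y) →
                        ParentFunctionOf adj r → ParentFunctionOf adj′ r
ParentFunctionOf-resp adj≗adj′ P = record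
  { parentFunction        = parentFunction
  ; parent-adjacent       = λ x≢r → subst T (adj≗adj′ _ _) (parent-adjacent x≢r)
  ; adjacent⇒parent-step = λ e → adjacent⇒parent-step (subst T (sym (adj≗adj′ _ _)) e)
  }
  where open ParentFunctionOf P

adj≡parentAdj : ∀ {m} {adj : Adj m} {r} → SymmetricAdj adj → (P : ParentFunctionOf adj r) →
                ∀ x y → adj x y ≡ parentAdj r (ParentFunctionOf.parent P) x y
adj≡parentAdj {adj = adj} adj-sym P x y =
  T⇔T⇒≡ (parentAdj⁺ x y ∘ adjacent⇒parent-step) (edge ∘ parentAdj⁻ x y)
  where
    open ParentFunctionOf P
    edge : ParentStep _ parent x y ⊎ ParentStep _ parent y x → T (adj x y)
    edge (inj₁ (x≢r , refl)) = parent-adjacent x≢r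
    edge (inj₂ (y≢r , refl)) = adj-sym (parent-adjacent y≢r)

-- Boolean vectors and matrices

_≟ᵇ_ : ∀ {l} → Fin l → Fin l → Bool
i ≟ᵇ j = does (i ≟ j)

≟ᵇ-refl : ∀ {l} (i : Fin l) → i ≟ᵇ i ≡ true
≟ᵇ-refl i = dec-true (i ≟ i) refl

≟ᵇ-≢ : ∀ {l} {i j : Fin l} → i ≢ j → i ≟ᵇ j ≡ false
≟ᵇ-≢ {i = i} {j} = dec-false (i ≟ j)

≟ᵇ-injective : ∀ {l l′} (f : Fin l → Fin l′) → (∀ {i j} → f i ≡ f j → i ≡ j) →
               ∀ i j → f i ≟ᵇ f j ≡ i ≟ᵇ j
≟ᵇ-injective f f-injective i j = does-⇔ (mk⇔ f-injective (cong f)) (f i ≟ f j) (i ≟ j)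

entry : ∀ {r c} → Vec (Vec Bool c) r → Fin r → Fin c → Bool
entry M i j = lookup (lookup M i) j

matrix : ∀ {r c} → (Fin r → Fin c → Bool) → Vec (Vec Bool c) r
matrix F = tabulate (λ i → tabulate (F i))

module _ {r c : ℕ} where

  entry-matrix : ∀ (F : Fin r → Fin c → Bool) i j → entry (matrix F) i j ≡ F i j
  entry-matrix F i j = trans (cong (λ row → lookup row j) (lookup∘tabulate _ i)) (lookup∘tabulate (F i) j)

  matrix-cong : ∀ {F G : Fin r → Fin c → Bool} → (∀ i j → F i j ≡ G i j) → matrix F ≡ matrix G
  matrix-cong F≗G = tabulate-cong (λ i → tabulate-cong (F≗G i))

  matrix-entry : ∀ (M : Vec (Vec Bool c) r) → matrix (entry M) ≡ M
  matrix-entry M = trans (tabulate-cong (λ i → tabulate∘lookup (lookup M i))) (tabulate∘lookup M)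

  entry-ext : ∀ {M M′ : Vec (Vec Bool c) r} → (∀ i j → entry M i j ≡ entry M′ i j) → M ≡ M′
  entry-ext {M} {M′} M≗M′ = trans (sym (matrix-entry M)) (trans (matrix-cong M≗M′) (matrix-entry M′))

  column-entry : ∀ (M : Vec (Vec Bool c) r) j → column M j ≡ tabulate (λ i → entry M i j)
  column-entry M j =
    trans (sym (tabulate∘lookup (column M j))) (tabulate-cong (λ i → lookup-map i (λ row → lookup row j) M))

  column-matrix : ∀ (F : Fin r → Fin c → Bool) j → column (matrix F) j ≡ tabulate (λ i → F i j)
  column-matrix F j = trans (column-entry (matrix F) j) (tabulate-cong (λ i → entry-matrix F i j))

ones-zero : ∀ {l} (v : Vec Bool l) → ones v ≡ 0 → ∀ j → lookup v j ≡ false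
ones-zero (false ∷ v) none zero    = refl
ones-zero (false ∷ v) none (suc j) = ones-zero v none j

ones-one : ∀ {l} (v : Vec Bool l) → ones v ≡ 1 → ∃[ c ] ∀ j → lookup v j ≡ c ≟ᵇ j
ones-one (true ∷ v) one = zero , λ { zero → refl ; (suc j) → ones-zero v (suc-injective one) j }
ones-one (false ∷ v) one with ones-one v one
... | c , v≗c =
  suc c , λ { zero → refl ; (suc j) → trans (v≗c j) (sym (≟ᵇ-injective suc Fin.suc-injective c j)) }

ones-tabulate-one : ∀ {l} (c : Fin l) (f : Fin l → Bool) → (∀ j → f j ≡ c ≟ᵇ j) → ones (tabulate f) ≡ 1
ones-tabulate-one {suc l} zero f f≗c rewrite f≗c zero =
  cong suc (trans (cong ones (tabulate-cong (λ j → trans (f≗c (suc j)) (≟ᵇ-≢ {i = zero} {j = suc j} λ ()))))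
                  (ones-false l))
  where ones-false : ∀ l → ones (tabulate {n = l} (λ _ → false)) ≡ 0
        ones-false zero    = refl
        ones-false (suc l) = ones-false l
ones-tabulate-one (suc c) f f≗c rewrite trans (f≗c zero) (≟ᵇ-≢ {i = suc c} {j = zero} λ ()) =
  ones-tabulate-one c (f ∘ suc) (λ j → trans (f≗c (suc j)) (≟ᵇ-injective suc Fin.suc-injective c j))

ones-tabulate-∨ : ∀ {l} (f : Fin l → Bool) p → f p ≡ false →
                  ones (tabulate (λ i → f i ∨ (i ≟ᵇ p))) ≡ suc (ones (tabulate f))
ones-tabulate-∨ f zero fp≡false rewrite fp≡false =
  cong suc (cong ones (tabulate-cong λ i →
    trans (cong (f (suc i) ∨_) (≟ᵇ-≢ {i = suc i} {j = zero} λ ())) (∨-identityʳ (f (suc i)))))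
ones-tabulate-∨ f (suc p) fp≡false = begin
  ones ((f zero ∨ (zero ≟ᵇ suc p)) ∷ tabulate (λ i → f (suc i) ∨ (suc i ≟ᵇ suc p)))
    ≡⟨ cong ones (cong₂ _∷_ (trans (cong (f zero ∨_) (≟ᵇ-≢ {i = zero} {j = suc p} λ ())) (∨-identityʳ (f zero)))
                            (tabulate-cong λ i → cong (f (suc i) ∨_) (≟ᵇ-injective suc Fin.suc-injective i p))) ⟩
  ones (f zero ∷ tabulate (λ i → f (suc i) ∨ (i ≟ᵇ p)))
    ≡⟨ ones-∷-suc (f zero) (ones-tabulate-∨ (f ∘ suc) p fp≡false) ⟩
  suc (ones (f zero ∷ tabulate (f ∘ suc)))
    ∎
  where
    open ≡-Reasoning
    ones-∷-suc : ∀ b {l} {v v′ : Vec Bool l} → ones v ≡ suc (ones v′) → ones (b ∷ v) ≡ suc (ones (b ∷ v′))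
    ones-∷-suc true  eq = cong suc eq
    ones-∷-suc false eq = eq

rank : ∀ {l} → Vec Bool l → Fin l → ℕ
rank (_     ∷ v) zero    = 0
rank (true  ∷ v) (suc i) = suc (rank v i)
rank (false ∷ v) (suc i) = rank v i

select : ∀ {l} → Vec Bool l → ℕ → Maybe (Fin l)
select []          t       = nothing
select (true  ∷ v) zero    = just zero
select (true  ∷ v) (suc t) = Maybe.map suc (select v t)
select (false ∷ v) t       = Maybe.map suc (select v t)

select-rank : ∀ {l} (v : Vec Bool l) i → lookup v i ≡ true → select v (rank v i) ≡ just i
select-rank (true  ∷ v) zero    _ = refl
select-rank (true  ∷ v) (suc i) t = cong (Maybe.map suc) (select-rank v i t)
select-rank (false ∷ v) (suc i) t = cong (Maybe.map suc) (select-rank v i t)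

rank<ones : ∀ {l} (v : Vec Bool l) i → lookup v i ≡ true → rank v i < ones v
rank<ones (true  ∷ v) zero    _ = s≤s z≤n
rank<ones (true  ∷ v) (suc i) t = s≤s (rank<ones v i t)
rank<ones (false ∷ v) (suc i) t = rank<ones v i t

select-spec : ∀ {l} (v : Vec Bool l) t → t < ones v →
              ∃[ i ] select v t ≡ just i × lookup v i ≡ true × rank v i ≡ t
select-spec (true  ∷ v) zero    _ = zero , refl , refl , refl
select-spec (true  ∷ v) (suc t) t<ones with select-spec v t (≤-pred t<ones)
... | i , sel , look , rk = suc i , cong (Maybe.map suc) sel , look , cong suc rk
select-spec (false ∷ v) t       t<ones with select-spec v t t<ones
... | i , sel , look , rk = suc i , cong (Maybe.map suc) sel , look , rk

-- A vector indexed by the non-last elements of Fin (suc n′), read as a function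
-- on all of Fin (suc n′) with the dummy value x at the last element.
extend : ∀ {n′} {X : Set} → X → Vec X n′ → Fin (suc n′) → X
extend x v = lookup (v ∷ʳ x)

module _ {X : Set} (x : X) where

  extend-inject₁ : ∀ {n′} (v : Vec X n′) t → extend x v (inject₁ t) ≡ lookup v t
  extend-inject₁ (y ∷ v) zero    = refl
  extend-inject₁ (y ∷ v) (suc t) = extend-inject₁ v t

  tabulate-extend : ∀ {n′} (v : Vec X n′) → tabulate (extend x v ∘ inject₁) ≡ v
  tabulate-extend v = trans (tabulate-cong (extend-inject₁ v)) (tabulate∘lookup v)

  extend-tabulate : ∀ {n′} (f : Fin (suc n′) → X) j → j ≢ fromℕ n′ →
                    extend x (tabulate (f ∘ inject₁)) j ≡ f j
  extend-tabulate {n′} f j j≢last =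
    subst (λ j′ → extend x (tabulate (f ∘ inject₁)) j′ ≡ f j′) (Fin.inject₁-lower₁ j n′≢j)
      (trans (extend-inject₁ (tabulate (f ∘ inject₁)) (lower₁ j n′≢j))
             (lookup∘tabulate (f ∘ inject₁) (lower₁ j n′≢j)))
    where
      n′≢j : n′ ≢ toℕ j
      n′≢j n′≡j = j≢last (Fin.toℕ-injective (trans (sym n′≡j) (sym (Fin.toℕ-fromℕ n′))))

-- The correspondence

module Correspondence (k′ n′ : ℕ) where

  k n N : ℕ
  k = suc k′
  n = suc n′
  N = k * n

  root : Fin n
  root = fromℕ n′

  toℕ≡n′⇒root : ∀ {j : Fin n} → toℕ j ≡ n′ → j ≡ root
  toℕ≡n′⇒root eq = Fin.toℕ-injective (trans eq (sym (Fin.toℕ-fromℕ n′)))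

  u : Fin N → Fin (N + n)
  u i = i ↑ˡ n

  w : Fin n → Fin (N + n)
  w j = N ↑ʳ j

  rootB : Fin (N + n)
  rootB = w root

  data View : Fin (N + n) → Set where
    isU : ∀ i → View (u i)
    isW : ∀ j → View (w j)

  view : ∀ x → View x
  view x with splitAt N x in eq
  ... | inj₁ i = subst View (Fin.splitAt⁻¹-↑ˡ eq) (isU i)
  ... | inj₂ j = subst View (Fin.splitAt⁻¹-↑ʳ eq) (isW j)

  u≢w : ∀ {i j} → u i ≢ w j
  u≢w {i} {j} eq with trans (sym (Fin.splitAt-↑ˡ N i n)) (trans (cong (splitAt N) eq) (Fin.splitAt-↑ʳ N n j))
  ... | ()

  u-injective : ∀ {i i′} → u i ≡ u i′ → i ≡ i′
  u-injective = Fin.↑ˡ-injective n _ _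

  w-injective : ∀ {j j′} → w j ≡ w j′ → j ≡ j′
  w-injective = Fin.↑ʳ-injective N _ _

  uIndex : Fin (N + n) → Fin N
  uIndex x = Sum.[ id , (λ _ → zero) ] (splitAt N x)

  wIndex : Fin (N + n) → Fin n
  wIndex x = Sum.[ (λ _ → root) , id ] (splitAt N x)

  uIndex-u : ∀ i → uIndex (u i) ≡ i
  uIndex-u i = cong Sum.[ id , (λ _ → zero) ] (Fin.splitAt-↑ˡ N i n)

  wIndex-w : ∀ j → wIndex (w j) ≡ j
  wIndex-w j = cong Sum.[ (λ _ → root) , id ] (Fin.splitAt-↑ʳ N n j)

  adjB : BipData k n → Adj (N + n)
  adjB = bipAdj {k} {n}

  module _ (B : BipData k n) where

    adj-uw : ∀ i j → adjB B (u i) (w j) ≡ entry B i j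
    adj-uw i j rewrite Fin.splitAt-↑ˡ N i n | Fin.splitAt-↑ʳ N n j = refl

    adj-wu : ∀ i j → adjB B (w j) (u i) ≡ entry B i j
    adj-wu i j rewrite Fin.splitAt-↑ˡ N i n | Fin.splitAt-↑ʳ N n j = refl

    adj-uu : ∀ i i′ → adjB B (u i) (u i′) ≡ false
    adj-uu i i′ rewrite Fin.splitAt-↑ˡ N i n | Fin.splitAt-↑ˡ N i′ n = refl

    adj-ww : ∀ j j′ → adjB B (w j) (w j′) ≡ false
    adj-ww j j′ rewrite Fin.splitAt-↑ʳ N n j | Fin.splitAt-↑ʳ N n j′ = refl

    adjB-sym : SymmetricAdj (adjB B)
    adjB-sym {x} {y} e with view x | view y
    ... | isU i | isU i′ = ⊥-elim (subst T (adj-uu i i′) e)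
    ... | isU i | isW j  = subst T (sym (adj-wu i j)) (subst T (adj-uw i j) e)
    ... | isW j | isU i  = subst T (sym (adj-uw i j)) (subst T (adj-wu i j) e)
    ... | isW j | isW j′ = ⊥-elim (subst T (adj-ww j j′) e)

    adjB-irrefl : IrreflexiveAdj (adjB B)
    adjB-irrefl {x} e with view x
    ... | isU i = subst T (adj-uu i i) e
    ... | isW j = subst T (adj-ww j j) e

  ExtraEdge : (Fin n → Fin N) → Fin N → Fin n → Set
  ExtraEdge s i j = j ≢ root × i ≡ s j

  extraEdge? : ∀ s i j → Dec (ExtraEdge s i j)
  extraEdge? s i j = ¬? (j ≟ root) ×-dec (i ≟ s j)

  glueEntry : MatData k n → (Fin n → Fin N) → Fin N → Fin n → Bool
  glueEntry M s i j = entry M i j ∨ does (extraEdge? s i j)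

  glue : MatData k n → (Fin n → Fin N) → BipData k n
  glue M s = matrix (glueEntry M s)

  module _ (M : MatData k n) (s : Fin n → Fin N) where

    glue⁺ : ∀ {i j} → T (entry M i j) ⊎ ExtraEdge s i j → T (entry (glue M s) i j)
    glue⁺ {i} {j} e = subst T (sym (entry-matrix (glueEntry M s) i j))
                        (Equivalence.from T-∨ (Sum.map₂ (T-does⁺ (extraEdge? s i j)) e))

    glue⁻ : ∀ {i j} → T (entry (glue M s) i j) → T (entry M i j) ⊎ ExtraEdge s i j
    glue⁻ {i} {j} e = Sum.map₂ (T-does⁻ (extraEdge? s i j))
                        (Equivalence.to T-∨ (subst T (entry-matrix (glueEntry M s) i j) e))

    ones-column-glue-root : ones (column (glue M s) root) ≡ ones (column M root)
    ones-column-glue-root = begin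
      ones (column (glue M s) root)                                       ≡⟨ cong ones (column-matrix (glueEntry M s) root) ⟩
      ones (tabulate (λ i → entry M i root ∨ does (extraEdge? s i root))) ≡⟨ cong ones (tabulate-cong no-extra) ⟩
      ones (tabulate (λ i → entry M i root))                              ≡⟨ cong ones (column-entry M root) ⟨
      ones (column M root)                                                ∎
      where
        open ≡-Reasoning
        no-extra : ∀ i → entry M i root ∨ does (extraEdge? s i root) ≡ entry M i root
        no-extra i = trans (cong (entry M i root ∨_) (dec-false (extraEdge? s i root) λ (r≢r , _) → r≢r refl))
                           (∨-identityʳ _)

    ones-column-glue : ∀ {j} → j ≢ root → entry M (s j) j ≡ false →
                       ones (column (glue M s) j) ≡ suc (ones (column M j))
    ones-column-glue {j} j≢root fresh = begin
      ones (column (glue M s) j)                                      ≡⟨ cong ones (column-matrix (glueEntry M s) j) ⟩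
      ones (tabulate (λ i → entry M i j ∨ does (extraEdge? s i j)))   ≡⟨ cong ones (tabulate-cong extra-at-s) ⟩
      ones (tabulate (λ i → entry M i j ∨ (i ≟ᵇ s j)))                ≡⟨ ones-tabulate-∨ (λ i → entry M i j) (s j) fresh ⟩
      suc (ones (tabulate (λ i → entry M i j)))                       ≡⟨ cong (suc ∘ ones) (column-entry M j) ⟨
      suc (ones (column M j))                                         ∎
      where
        open ≡-Reasoning
        extra-at-s : ∀ i → entry M i j ∨ does (extraEdge? s i j) ≡ entry M i j ∨ (i ≟ᵇ s j)
        extra-at-s i = cong (entry M i j ∨_) (does-⇔ (mk⇔ proj₂ (j≢root ,_)) (extraEdge? s i j) (i ≟ s j))

    glue-RightDegrees : (∀ j → ones (column M j) ≡ k) → (∀ {j} → j ≢ root → entry M (s j) j ≡ false) →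
                        RightDegrees k n (glue M s)
    glue-RightDegrees columns fresh j = at-root , off-root
      where
        at-root : toℕ j ≡ n′ → ones (column (glue M s) j) ≡ k
        at-root eq rewrite toℕ≡n′⇒root eq = trans (ones-column-glue-root) (columns root)
        off-root : toℕ j ≢ n′ → ones (column (glue M s) j) ≡ suc k
        off-root ne = trans (ones-column-glue j≢root (fresh j≢root)) (cong suc (columns j))
          where j≢root = λ j≡root → ne (trans (cong toℕ j≡root) (Fin.toℕ-fromℕ n′))

    RightDegrees-glue : RightDegrees k n (glue M s) → (∀ {j} → j ≢ root → entry M (s j) j ≡ false) →
                        ∀ j → ones (column M j) ≡ k
    RightDegrees-glue degrees fresh j with j ≟ root
    ... | yes refl    = trans (sym ones-column-glue-root) (proj₁ (degrees root) (Fin.toℕ-fromℕ n′))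
    ... | no j≢root = suc-injective (trans (sym (ones-column-glue j≢root (fresh j≢root)))
                                            (proj₂ (degrees j) (j≢root ∘ toℕ≡n′⇒root)))

  glue-cong : ∀ M {s s′} → (∀ {j} → j ≢ root → s j ≡ s′ j) → glue M s ≡ glue M s′
  glue-cong M {s} {s′} s≗s′ = matrix-cong λ i j →
    cong (entry M i j ∨_) (does-⇔ (mk⇔ (λ (j≢root , i≡sj) → j≢root , trans i≡sj (s≗s′ j≢root))
                                        (λ (j≢root , i≡s′j) → j≢root , trans i≡s′j (sym (s≗s′ j≢root))))
                                   (extraEdge? s i j) (extraEdge? s′ i j))

  module GlueTree (M : MatData k n) (col : Fin N → Fin n) (M≗col : ∀ i j → entry M i j ≡ col i ≟ᵇ j)
                  (F : ParentFunction root) (s : Fin n → Fin N)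
                  (col∘s : ∀ {j} → j ≢ root → col (s j) ≡ ParentFunction.parent F j) where
    open ParentFunction F

    B : BipData k n
    B = glue M s

    M⁺ : ∀ i → T (entry M i (col i))
    M⁺ i = subst T (sym (trans (M≗col i (col i)) (≟ᵇ-refl (col i)))) tt

    M⁻ : ∀ {i j} → T (entry M i j) → col i ≡ j
    M⁻ {i} {j} e = T-does⁻ (col i ≟ j) (subst T (M≗col i j) e)

    wParent : Fin n → Fin (N + n)
    wParent j with j ≟ root
    ... | yes _ = rootB
    ... | no _  = u (s j)

    wParent-root : wParent root ≡ rootB
    wParent-root with root ≟ root
    ... | yes _     = refl
    ... | no r≢r = ⊥-elim (r≢r refl)

    wParent-≢root : ∀ {j} → j ≢ root → wParent j ≡ u (s j)
    wParent-≢root {j} j≢root with j ≟ root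
    ... | yes j≡root = ⊥-elim (j≢root j≡root)
    ... | no _       = refl

    bipParent : Fin (N + n) → Fin (N + n)
    bipParent x = Sum.[ w ∘ col , wParent ] (splitAt N x)

    bipHeight : Fin (N + n) → ℕ
    bipHeight x = Sum.[ (λ i → suc (double (height (col i)))) , double ∘ height ] (splitAt N x)
      where double = λ a → a + a

    bipParent-u : ∀ i → bipParent (u i) ≡ w (col i)
    bipParent-u i = cong Sum.[ w ∘ col , wParent ] (Fin.splitAt-↑ˡ N i n)

    bipParent-w : ∀ j → bipParent (w j) ≡ wParent j
    bipParent-w j = cong Sum.[ w ∘ col , wParent ] (Fin.splitAt-↑ʳ N n j)

    bipHeight-u : ∀ i → bipHeight (u i) ≡ suc (height (col i) + height (col i))
    bipHeight-u i = cong Sum.[ _ , _ ] (Fin.splitAt-↑ˡ N i n)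

    bipHeight-w : ∀ j → bipHeight (w j) ≡ height j + height j
    bipHeight-w j = cong Sum.[ _ , _ ] (Fin.splitAt-↑ʳ N n j)

    w≢rootB : ∀ {j} → w j ≢ rootB → j ≢ root
    w≢rootB w≢ j≡root = w≢ (cong w j≡root)

    bipParentFunction : ParentFunction rootB
    bipParentFunction = record
      { parent        = bipParent
      ; height        = bipHeight
      ; parent-root   = trans (bipParent-w root) wParent-root
      ; height-parent = height-bipParent
      }
      where
        height-bipParent : ∀ {x} → x ≢ rootB → bipHeight (bipParent x) < bipHeight x
        height-bipParent {x} x≢r with view x
        ... | isU i rewrite bipParent-u i | bipHeight-u i | bipHeight-w (col i) = ≤-refl
        ... | isW j rewrite bipParent-w j | wParent-≢root (w≢rootB x≢r) | bipHeight-u (s j) | bipHeight-w j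
                          | col∘s (w≢rootB x≢r) =
          subst (_≤ height j + height j) (cong suc (+-suc _ _)) (+-mono-≤ lt lt)
          where lt = height-parent (w≢rootB x≢r)

    edge-uw : ∀ {i j} → T (entry B i j) →
              ParentStep rootB bipParent (u i) (w j) ⊎ ParentStep rootB bipParent (w j) (u i)
    edge-uw {i} {j} e with glue⁻ M s e
    ... | inj₁ m               = inj₁ (u≢w , trans (cong w (sym (M⁻ m))) (sym (bipParent-u i)))
    ... | inj₂ (j≢root , refl) =
      inj₂ ((j≢root ∘ w-injective) , sym (trans (bipParent-w j) (wParent-≢root j≢root)))

    parentFunctionOf : ParentFunctionOf (adjB B) rootB
    parentFunctionOf = record
      { parentFunction        = bipParentFunction
      ; parent-adjacent       = adjacent
      ; adjacent⇒parent-step = steps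
      }
      where
        adjacent : ∀ {x} → x ≢ rootB → T (adjB B x (bipParent x))
        adjacent {x} x≢r with view x
        ... | isU i rewrite bipParent-u i | adj-uw B i (col i) = glue⁺ M s (inj₁ (M⁺ i))
        ... | isW j rewrite bipParent-w j | wParent-≢root (w≢rootB x≢r) | adj-wu B (s j) j =
          glue⁺ M s (inj₂ (w≢rootB x≢r , refl))
        steps : ∀ {x y} → T (adjB B x y) → ParentStep rootB bipParent x y ⊎ ParentStep rootB bipParent y x
        steps {x} {y} e with view x | view y
        ... | isU i | isU i′ = ⊥-elim (subst T (adj-uu B i i′) e)
        ... | isW j | isW j′ = ⊥-elim (subst T (adj-ww B j j′) e)
        ... | isU i | isW j  = edge-uw (subst T (adj-uw B i j) e)
        ... | isW j | isU i  = Sum.swap (edge-uw (subst T (adj-wu B i j) e))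

    fresh : ∀ {j} → j ≢ root → entry M (s j) j ≡ false
    fresh {j} j≢root = trans (M≗col (s j) j) (≟ᵇ-≢ λ col-sj≡j →
      <-irrefl (cong height (trans (sym (col∘s j≢root)) col-sj≡j)) (height-parent j≢root))

  extraRow : MatData k n → (Fin n → Fin n) → (Fin n → Fin k) → Fin n → Fin N
  extraRow M parent letter j = fromMaybe zero (select (column M (parent j)) (toℕ (letter j)))

  toBip : MatData k n → (Fin n → Fin n) → (Fin n → Fin k) → BipData k n
  toBip M parent letter = glue M (extraRow M parent letter)

  toBip-cong : ∀ M {p q a b} → (∀ j → p j ≡ q j) → (∀ {j} → j ≢ root → a j ≡ b j) →
               toBip M p a ≡ toBip M q b
  toBip-cong M p≗q a≗b = glue-cong M λ {j} j≢root →
    cong₂ (λ c t → fromMaybe zero (select (column M c) (toℕ t))) (p≗q j) (a≗b j≢root)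

  module Forward (M : MatData k n) (isMat : IsMat k n M) (F : ParentFunction root) (letter : Fin n → Fin k) where
    open ParentFunction F

    col : Fin N → Fin n
    col i = proj₁ (ones-one (lookup M i) (proj₁ isMat i))

    M≗col : ∀ i j → entry M i j ≡ col i ≟ᵇ j
    M≗col i = proj₂ (ones-one (lookup M i) (proj₁ isMat i))

    s : Fin n → Fin N
    s = extraRow M parent letter

    s-spec : ∀ j → entry M (s j) (parent j) ≡ true × rank (column M (parent j)) (s j) ≡ toℕ (letter j)
    s-spec j with select-spec (column M (parent j)) (toℕ (letter j))
                    (subst (toℕ (letter j) <_) (sym (proj₂ isMat (parent j))) (Fin.toℕ<n (letter j)))
    ... | i , sel , look , rk rewrite sel = trans (sym (lookup-map i (λ row → lookup row (parent j)) M)) look , rk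

    col∘s : ∀ j → col (s j) ≡ parent j
    col∘s j = T-does⁻ (col (s j) ≟ parent j) (subst T (trans (sym (proj₁ (s-spec j))) (M≗col (s j) (parent j))) tt)

    open GlueTree M col M≗col F s (λ {j} _ → col∘s j) public

    isST : IsST k n (toBip M parent letter)
    isST = ParentFunctionOf⇒Tree.isTree (λ {x} {y} → adjB-sym B {x} {y}) parentFunctionOf ,
           glue-RightDegrees M s (proj₂ isMat) fresh

  -- The rank is < k wherever it matters; mod k only casts it into Fin k.
  letterOf : MatData k n → (Fin n → Fin n) → (Fin n → Fin N) → Fin n → Fin k
  letterOf M parent s j = rank (column M (parent j)) (s j) mod k

  toℕ-mod : ∀ (t : Fin k) → toℕ t mod k ≡ t
  toℕ-mod t = Fin.toℕ-injective (trans (Fin.toℕ-fromℕ< _) (m<n⇒m%n≡m (Fin.toℕ<n t)))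

  module FromParent (bp : Fin (N + n) → Fin (N + n)) where

    col : Fin N → Fin n
    col = wIndex ∘ bp ∘ u

    extra : Fin n → Fin N
    extra = uIndex ∘ bp ∘ w

    parent : Fin n → Fin n
    parent = wIndex ∘ bp ∘ bp ∘ w

    matEntry : Fin N → Fin n → Bool
    matEntry i j = col i ≟ᵇ j

    mat : MatData k n
    mat = matrix matEntry

    tree : TreeData n
    tree = matrix (parentAdj root parent)

    word : Vec (Fin k) n′
    word = tabulate (letterOf mat parent extra ∘ inject₁)

    domData : DomData k n
    domData = mat , tree , word

  domData-cong : ∀ {bp bq} → (∀ x → bp x ≡ bq x) → FromParent.domData bp ≡ FromParent.domData bq
  domData-cong {bp} {bq} bp≗bq = cong₂ _,_ mat≡ (cong₂ _,_ (matrix-cong (parentAdj-cong root parent≗)) word≡)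
    where
      module P = FromParent bp
      module Q = FromParent bq
      col≗ : ∀ i → P.col i ≡ Q.col i
      col≗ i = cong wIndex (bp≗bq (u i))
      parent≗ : ∀ j → P.parent j ≡ Q.parent j
      parent≗ j = cong wIndex (trans (bp≗bq (bp (w j))) (cong bq (bp≗bq (w j))))
      mat≡ : P.mat ≡ Q.mat
      mat≡ = matrix-cong λ i j → cong (_≟ᵇ j) (col≗ i)
      word≡ : P.word ≡ Q.word
      word≡ = tabulate-cong λ t → cong₂ (λ M (c , i) → rank (column M c) i mod k) mat≡
                (cong₂ _,_ (parent≗ (inject₁ t)) (cong uIndex (bp≗bq (w (inject₁ t)))))

  module Backward (B : BipData k n) (P : ParentFunctionOf (adjB B) rootB) (degrees : RightDegrees k n B) where
    module P = ParentFunctionOf P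
    open FromParent P.parent

    parent-u : ∀ i → P.parent (u i) ≡ w (col i)
    parent-u i with P.parent (u i) | P.parent-adjacent {u i} u≢w
    ... | y | e with view y
    ...   | isU i′ = ⊥-elim (subst T (adj-uu B i i′) e)
    ...   | isW j  = cong w (sym (wIndex-w j))

    parent-w : ∀ {j} → j ≢ root → P.parent (w j) ≡ u (extra j)
    parent-w {j} j≢root with P.parent (w j) | P.parent-adjacent {w j} (j≢root ∘ w-injective)
    ... | y | e with view y
    ...   | isU i  = cong u (sym (uIndex-u i))
    ...   | isW j′ = ⊥-elim (subst T (adj-ww B j j′) e)

    col∘extra : ∀ {j} → j ≢ root → col (extra j) ≡ parent j
    col∘extra j≢root = cong (wIndex ∘ P.parent) (sym (parent-w j≢root))

    parentFunction : ParentFunction root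
    parentFunction = record
      { parent        = parent
      ; height        = P.height ∘ w
      ; parent-root   = trans (cong (wIndex ∘ P.parent) P.parent-root)
                              (trans (cong wIndex P.parent-root) (wIndex-w root))
      ; height-parent = height-parent
      }
      where
        height-parent : ∀ {j} → j ≢ root → P.height (w (parent j)) < P.height (w j)
        height-parent {j} j≢root = begin-strict
          P.height (w (parent j))             ≡⟨ cong (P.height ∘ w) (col∘extra j≢root) ⟨
          P.height (w (col (extra j)))        ≡⟨ cong P.height (parent-u (extra j)) ⟨
          P.height (P.parent (u (extra j)))   <⟨ P.height-parent u≢w ⟩
          P.height (u (extra j))              ≡⟨ cong P.height (parent-w j≢root) ⟨
          P.height (P.parent (w j))           <⟨ P.height-parent (j≢root ∘ w-injective) ⟩
          P.height (w j)                      ∎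
          where open ≤-Reasoning

    mat⁻ : ∀ {i j} → T (entry mat i j) → col i ≡ j
    mat⁻ {i} {j} e = T-does⁻ (col i ≟ j) (subst T (entry-matrix matEntry i j) e)

    mat⁺ : ∀ {i j} → col i ≡ j → T (entry mat i j)
    mat⁺ {i} {j} col-i≡j = subst T (sym (entry-matrix matEntry i j)) (T-does⁺ (col i ≟ j) col-i≡j)

    B≡glue : B ≡ glue mat extra
    B≡glue = entry-ext λ i j → T⇔T⇒≡ (to i j) (from i j)
      where
        to : ∀ i j → T (entry B i j) → T (entry (glue mat extra) i j)
        to i j e with P.adjacent⇒parent-step (subst T (sym (adj-uw B i j)) e)
        ... | inj₁ (_ , wj≡) =
          glue⁺ mat extra {i} {j} (inj₁ (mat⁺ {i} {j} (sym (w-injective (trans wj≡ (parent-u i))))))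
        ... | inj₂ (wj≢rootB , ui≡) =
          glue⁺ mat extra {i} {j} (inj₂ (j≢root , u-injective (trans ui≡ (parent-w j≢root))))
          where j≢root = wj≢rootB ∘ cong w
        from : ∀ i j → T (entry (glue mat extra) i j) → T (entry B i j)
        from i j e with glue⁻ mat extra {i} {j} e
        ... | inj₁ m = subst T (adj-uw B i j)
                         (subst (T ∘ adjB B (u i)) (trans (parent-u i) (cong w (mat⁻ {i} {j} m)))
                           (P.parent-adjacent {u i} u≢w))
        ... | inj₂ (j≢root , i≡extra) = subst T (adj-wu B i j)
                         (subst (T ∘ adjB B (w j)) (trans (parent-w j≢root) (cong u (sym i≡extra)))
                           (P.parent-adjacent (j≢root ∘ w-injective)))

    fresh : ∀ {j} → j ≢ root → entry mat (extra j) j ≡ false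
    fresh {j} j≢root = trans (entry-matrix matEntry (extra j) j) (≟ᵇ-≢ λ col≡j →
      <-irrefl (cong (P.height ∘ w) (trans (sym (col∘extra j≢root)) col≡j))
               (ParentFunction.height-parent parentFunction j≢root))

    isMat : IsMat k n mat
    isMat = (λ i → trans (cong ones (lookup∘tabulate (tabulate ∘ matEntry) i))
                         (ones-tabulate-one (col i) _ λ _ → refl)) ,
            RightDegrees-glue mat extra (subst (RightDegrees k n) B≡glue degrees) fresh

    parentFunctionOf-tree : ParentFunctionOf (matAdj tree) root
    parentFunctionOf-tree = ParentFunctionOf-resp (λ x y → sym (entry-matrix (parentAdj root parent) x y))
                                                  (parentAdj-ParentFunctionOf parentFunction)

    isRootedTree : IsRootedTree n tree
    isRootedTree = comm , irrefl , ParentFunctionOf⇒Tree.isTree (λ {x} {y} → subst T (comm x y)) parentFunctionOf-tree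
      where
        comm : ∀ x y → matAdj tree x y ≡ matAdj tree y x
        comm x y = trans (entry-matrix (parentAdj root parent) x y)
                         (trans (parentAdj-comm x y) (sym (entry-matrix (parentAdj root parent) y x)))
        irrefl : ∀ x → matAdj tree x x ≡ false
        irrefl x = trans (entry-matrix (parentAdj root parent) x x) (parentAdj-irrefl parentFunction x)

    extraRow≡extra : ∀ {j} → j ≢ root → extraRow mat parent (extend zero word) j ≡ extra j
    extraRow≡extra {j} j≢root = begin
      fromMaybe zero (select (column mat (parent j)) (toℕ (extend zero word j)))
        ≡⟨ cong (λ t → fromMaybe zero (select (column mat (parent j)) (toℕ t))) (extend-tabulate zero _ j j≢root) ⟩
      fromMaybe zero (select (column mat (parent j)) (toℕ (letterOf mat parent extra j)))
        ≡⟨ cong (fromMaybe zero ∘ select (column mat (parent j))) toℕ-letter ⟩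
      fromMaybe zero (select (column mat (parent j)) (rank (column mat (parent j)) (extra j)))
        ≡⟨ cong (fromMaybe zero) (select-rank (column mat (parent j)) (extra j) in-column) ⟩
      extra j ∎
      where
        open ≡-Reasoning
        in-column : lookup (column mat (parent j)) (extra j) ≡ true
        in-column = trans (lookup-map (extra j) (λ row → lookup row (parent j)) mat)
                          (trans (entry-matrix matEntry (extra j) (parent j))
                                 (trans (cong (_≟ᵇ parent j) (col∘extra j≢root)) (≟ᵇ-refl (parent j))))
        toℕ-letter : toℕ (letterOf mat parent extra j) ≡ rank (column mat (parent j)) (extra j)
        toℕ-letter = trans (Fin.toℕ-fromℕ< _)
          (m<n⇒m%n≡m (subst (rank (column mat (parent j)) (extra j) <_) (proj₂ isMat (parent j))
                        (rank<ones (column mat (parent j)) (extra j) in-column)))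

    toBip-fromParent : toBip mat parent (extend zero word) ≡ B
    toBip-fromParent = trans (glue-cong mat extraRow≡extra) (sym B≡glue)

  module Recovery (M : MatData k n) (isMat : IsMat k n M) (F : ParentFunction root) (letter : Fin n → Fin k) where
    open ParentFunction F
    open Forward M isMat F letter
      using (col; M≗col; s; s-spec; col∘s; bipParent; bipParent-u; bipParent-w; wParent-root; wParent-≢root)
    module G = FromParent bipParent

    col≡ : ∀ i → G.col i ≡ col i
    col≡ i = trans (cong wIndex (bipParent-u i)) (wIndex-w (col i))

    parent≡ : ∀ j → G.parent j ≡ parent j
    parent≡ j with j ≟ root
    ... | yes refl = trans (cong wIndex (trans (cong bipParent rootB-fixed) rootB-fixed))
                           (trans (wIndex-w root) (sym parent-root))
      where rootB-fixed = trans (bipParent-w root) wParent-root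
    ... | no j≢root = trans (cong (wIndex ∘ bipParent) (trans (bipParent-w j) (wParent-≢root j≢root)))
                            (trans (col≡ (s j)) (col∘s j))

    extra≡ : ∀ {j} → j ≢ root → G.extra j ≡ s j
    extra≡ {j} j≢root = trans (cong uIndex (trans (bipParent-w j) (wParent-≢root j≢root))) (uIndex-u (s j))

    mat≡ : G.mat ≡ M
    mat≡ = entry-ext λ i j →
      trans (entry-matrix G.matEntry i j) (trans (cong (_≟ᵇ j) (col≡ i)) (sym (M≗col i j)))

    letter≡ : ∀ {j} → j ≢ root → letterOf G.mat G.parent G.extra j ≡ letter j
    letter≡ {j} j≢root = begin
      letterOf G.mat G.parent G.extra j
        ≡⟨ cong₂ (λ M′ (c , i) → rank (column M′ c) i mod k) mat≡ (cong₂ _,_ (parent≡ j) (extra≡ j≢root)) ⟩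
      rank (column M (parent j)) (s j) mod k ≡⟨ cong (_mod k) (proj₂ (s-spec j)) ⟩
      toℕ (letter j) mod k                   ≡⟨ toℕ-mod (letter j) ⟩
      letter j                               ∎
      where open ≡-Reasoning

    recovers : G.domData ≡ (M , matrix (parentAdj root parent) , tabulate (letter ∘ inject₁))
    recovers = cong₂ _,_ mat≡ (cong₂ _,_ (matrix-cong (parentAdj-cong root parent≡))
                 (tabulate-cong λ t → letter≡ (λ inject₁t≡root → Fin.fromℕ≢inject₁ (sym inject₁t≡root))))

  rootedTreeParents : ∀ A → IsRootedTree n A → ParentFunctionOf (matAdj A) root
  rootedTreeParents A isRT =
    Tree⇒ParentFunctionOf.parentFunctionOf
      (λ {x} {y} → subst T (proj₁ isRT x y)) (λ {x} → subst T (proj₁ (proj₂ isRT) x))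
      (proj₂ (proj₂ isRT)) root

  spanningTreeParents : ∀ B → IsST k n B → ParentFunctionOf (adjB B) rootB
  spanningTreeParents B isST =
    Tree⇒ParentFunctionOf.parentFunctionOf
      (λ {x} {y} → adjB-sym B {x} {y}) (λ {x} → adjB-irrefl B {x}) (proj₁ isST) rootB

  treeParentFunction : ∀ A → IsRootedTree n A → ParentFunction root
  treeParentFunction A isRT = ParentFunctionOf.parentFunction (rootedTreeParents A isRT)

  toST : Σ (DomData k n) (InDom k n) → Σ (BipData k n) (IsST k n)
  toST ((M , A , v) , isMat , isRT) =
    toBip M (ParentFunction.parent (treeParentFunction A isRT)) (extend zero v) ,
    Forward.isST M isMat (treeParentFunction A isRT) (extend zero v)

  spanningData : ∀ B → IsST k n B → DomData k n
  spanningData B isST = FromParent.domData (ParentFunctionOf.parent (spanningTreeParents B isST))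

  fromST : Σ (BipData k n) (IsST k n) → Σ (DomData k n) (InDom k n)
  fromST (B , isST) =
    spanningData B isST ,
    Backward.isMat B (spanningTreeParents B isST) (proj₂ isST) ,
    Backward.isRootedTree B (spanningTreeParents B isST) (proj₂ isST)

  toST-cong : ∀ {x y} → proj₁ x ≡ proj₁ y → proj₁ (toST x) ≡ proj₁ (toST y)
  toST-cong {(M , A , v) , _ , isRT} {_ , _ , isRT′} refl =
    toBip-cong M {a = extend zero v} (parent-unique (rootedTreeParents A isRT) (rootedTreeParents A isRT′)) (λ _ → refl)

  fromST-cong : ∀ {x y} → proj₁ x ≡ proj₁ y → proj₁ (fromST x) ≡ proj₁ (fromST y)
  fromST-cong {B , isST} {_ , isST′} refl =
    domData-cong (parent-unique (spanningTreeParents B isST) (spanningTreeParents B isST′))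

  toST-fromST : ∀ y → proj₁ (toST (fromST y)) ≡ proj₁ y
  toST-fromST (B , isST) =
    trans (toBip-cong mat {a = extend zero word}
             (parent-unique (rootedTreeParents tree isRootedTree) parentFunctionOf-tree) (λ _ → refl))
          toBip-fromParent
    where open Backward B (spanningTreeParents B isST) (proj₂ isST)
          open FromParent (ParentFunctionOf.parent (spanningTreeParents B isST))

  fromST-toST : ∀ x → proj₁ (fromST (toST x)) ≡ proj₁ x
  fromST-toST x@((M , A , v) , isMat , isRT) =
    trans parents-agree (trans (Recovery.recovers M isMat F (extend zero v)) tree-word)
    where
      F : ParentFunction root
      F = treeParentFunction A isRT
      parents-agree : spanningData (proj₁ (toST x)) (proj₂ (toST x)) ≡
                      FromParent.domData (Forward.bipParent M isMat F (extend zero v))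
      parents-agree = domData-cong (parent-unique (spanningTreeParents (proj₁ (toST x)) (proj₂ (toST x)))
                                                  (Forward.parentFunctionOf M isMat F (extend zero v)))
      tree-word : (M , matrix (parentAdj root (ParentFunction.parent F)) , tabulate (extend zero v ∘ inject₁)) ≡
                  (M , A , v)
      tree-word = cong₂ _,_ refl (cong₂ _,_
        (trans (matrix-cong λ x y →
                  sym (adj≡parentAdj (λ {x} {y} → subst T (proj₁ isRT x y)) (rootedTreeParents A isRT) x y))
               (matrix-entry A))
        (tabulate-extend zero v))

  inverse : Inverse (MatRTreeWords k n) (STSet k n)
  inverse = record
    { to        = toST
    ; from      = fromST
    ; to-cong   = λ {x} {y} → toST-cong {x} {y}
    ; from-cong = λ {x} {y} → fromST-cong {x} {y}
    ; inverse   = (λ {y} {x} x≈ → trans (toST-cong {x} {fromST y} x≈) (toST-fromST y))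
                , (λ {x} {y} y≈ → trans (fromST-cong {y} {toST x} y≈) (fromST-toST x))
    }

lemma6p3 : (k n : ℕ) → 1 ≤ k → 1 ≤ n → Bijection (MatRTreeWords k n) (STSet k n)
lemma6p3 zero     _        ()  _
lemma6p3 (suc k′) zero     _   ()
lemma6p3 (suc k′) (suc n′) _   _ = Inverse⇒Bijection (Correspondence.inverse k′ n′)
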